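{- Let $\mu$ be the uniform distribution on $\textsc{Parity}_n^{ -1}(1)$. Then $D(\textsc{Parity}_n)=D_\mu(\textsc{Parity}_n)$.
   Context: $\textsc{Parity}_n(x)=1$ iff the number of ones in $x\in\{0,1\}^n$ is odd. A CNF formula is an AND of clauses (ORs of literals); its size $|\phi|$ is its number of clauses. For $f\colon\{0,1\}^n\to\{0,1\}$, $\mathrm{CNF}_f$ is the set of all CNF formulas $\phi$ with $\phi^{ -1}(1)\subseteq f^{ -1}(1)$. For a distribution $\mu$ on $f^{ -1}(1)$, $D_\mu(f):=\max_{\phi\in\mathrm{CNF}_f}\Pr_{x\sim\mu}[\phi(x)=1]/|\phi|$ (with $0/0=0$), and $D(f):=\min_\mu D_\mu(f)$ over all distributions $\mu$ on $f^{ -1}(1)$.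
   Formalization: The distributions in the minimum defining $D(\textsc{Parity}_n)$ have only rational masses on $\textsc{Parity}_n^{ -1}(1)$, rather than real ones. -}

module Defs where

open import Data.Bool using (Bool; true; false; if_then_else_; _xor_; _∧_; _∨_; not)
open import Data.Nat as ℕ using (ℕ; zero; suc; _∸_)
open import Data.Integer using (+_)
open import Data.Fin using (Fin)
open import Data.Vec using (Vec; []; _∷_; lookup)
open import Data.List as List using (List; []; _∷_; length)
open import Data.Product using (Σ; _×_; _,_)
open import Data.Rational using (ℚ; 0ℚ; 1ℚ; ½; _+_; _*_; _/_; _≤_)
open import Relation.Binary.PropositionalEquality using (_≡_)

-- Inputs x ∈ {0,1}^n, encoded as Vec Bool n (true = 1).
Input : ℕ → Set
Input n = Vec Bool n

allInputs : (n : ℕ) → List (Input n)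
allInputs zero = [] ∷ []
allInputs (suc n) =
  List.map (true ∷_) (allInputs n) List.++ List.map (false ∷_) (allInputs n)

parity : ∀ {n} → Input n → Bool
parity [] = false
parity (b ∷ x) = b xor parity x

-- A literal: variable index and polarity (true = positive literal x_i,
-- false = negated literal ¬x_i).
Literal : ℕ → Set
Literal n = Fin n × Bool

Clause : ℕ → Set
Clause n = List (Literal n)

CNF : ℕ → Set
CNF n = List (Clause n)

size : ∀ {n} → CNF n → ℕ
size = length

evalLit : ∀ {n} → Literal n → Input n → Bool
evalLit (i , true) x = lookup x i
evalLit (i , false) x = not (lookup x i)

evalClause : ∀ {n} → Clause n → Input n → Bool
evalClause [] x = false
evalClause (l ∷ c) x = evalLit l x ∨ evalClause c x

evalCNF : ∀ {n} → CNF n → Input n → Bool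
evalCNF [] x = true
evalCNF (c ∷ φ) x = evalClause c x ∧ evalCNF φ x

InCNF : ∀ {n} → (Input n → Bool) → CNF n → Set
InCNF f φ = ∀ x → evalCNF φ x ≡ true → f x ≡ true

sumℚ : List ℚ → ℚ
sumℚ = List.foldr _+_ 0ℚ

record Distribution {n : ℕ} (f : Input n → Bool) : Set where
  field
    mass     : Input n → ℚ
    nonneg   : ∀ x → 0ℚ ≤ mass x
    support  : ∀ x → f x ≡ false → mass x ≡ 0ℚ
    total    : sumℚ (List.map mass (allInputs n)) ≡ 1ℚ
open Distribution public

prob : ∀ {n} → (Input n → ℚ) → CNF n → ℚ
prob {n} μ φ =
  sumℚ (List.map (λ x → if evalCNF φ x then μ x else 0ℚ) (allInputs n))

-- Pr_{x∼μ}[φ(x)=1] / |φ|, with the convention 0/0 = 0 (|φ| = 0 gives 0).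
ratio : ∀ {n} → (Input n → ℚ) → CNF n → ℚ
ratio μ φ with size φ
... | zero  = 0ℚ
... | suc k = prob μ φ * (+ 1 / suc k)

IsDμ : ∀ {n} → (Input n → Bool) → (Input n → ℚ) → ℚ → Set
IsDμ {n} f μ d =
  Σ (CNF n) (λ φ → InCNF f φ × ratio μ φ ≡ d)
  × (∀ (φ : CNF n) → InCNF f φ → ratio μ φ ≤ d)

IsD : ∀ {n} → (Input n → Bool) → ℚ → Set
IsD f d =
  Σ (Distribution f) (λ μ → IsDμ f (mass μ) d)
  × (∀ (ν : Distribution f) (d' : ℚ) → IsDμ f (mass ν) d' → d ≤ d')

halfPow : ℕ → ℚ
halfPow zero = 1ℚ
halfPow (suc k) = ½ * halfPow k

-- Uniform distribution on Parity_n^{-1}(1), which has 2^{n-1} elements (n ≥ 1).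
uniformParity : (n : ℕ) → Input n → ℚ
uniformParity n x = if parity x then halfPow (n ∸ 1) else 0ℚ

-- D_μ(f) is attained for every f and every nonnegative μ: normalising each clause to the set of
-- its literals and the CNF to the set of its clauses keeps the accepted inputs and does not
-- increase the size, and there are only finitely many such normal forms.
--
-- For parity, translating a CNF φ by an even vector w, x ↦ φ (w ⊕ x), keeps it in CNF_Parity,
-- keeps its size and permutes the odd inputs. Hence, for any distribution ν on the odd inputs,
-- the ν-probabilities of acceptance of the 2^(n-1) even translates of φ sum to the number of odd
-- inputs accepted by φ, so one of them is at least the uniform probability Pr_μ[φ]. Taking φ
-- optimal for the uniform μ gives D_μ ≤ D_ν.

module Submission where

open import Defs
open import Data.Nat using (ℕ; _≤_)
open import Data.Product using (Σ; _×_)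
open import Data.Rational using (ℚ)

open import Algebra.Bundles using (CommutativeMonoid; CommutativeRing)
import Algebra.Properties.CommutativeSemigroup as CommutativeSemigroupProperties
open import Data.Bool using (Bool; true; false; not; _∧_; _∨_; _xor_; if_then_else_)
  renaming (_≟_ to _≟ᵇ_)
open import Data.Bool.Properties
  using (∨-zeroʳ; not-involutive; xor-assoc; xor-comm; xor-same; xor-identityʳ; xor-∧-commutativeRing)
open import Data.Empty using (⊥-elim)
open import Data.Fin using () renaming (_≟_ to _≟ᶠ_)
import Data.Integer as ℤ
import Data.Integer.Properties as ℤ
open import Data.List using (List; []; _∷_; [_]; _++_; map; filter; length; allFin; cartesianProduct; deduplicate)
import Data.List.Membership.DecPropositional as DecMembership
open import Data.List.Membership.Propositional using (_∈_)
open import Data.List.Membership.Propositional.Properties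
  using (∈-map⁺; ∈-map⁻; ∈-++⁺ˡ; ∈-++⁺ʳ; ∈-++⁻; ∈-∃++; ∈-filter⁺; ∈-filter⁻; ∈-cartesianProduct⁺; ∈-allFin; ∈-deduplicate⁺)
open import Data.List.Properties using (length-map) renaming (≡-dec to List-≡-dec)
open import Data.List.Relation.Binary.Permutation.Propositional.Properties using (↭-length) renaming (shift to ↭-shift)
open import Data.List.Relation.Binary.Subset.Propositional using (_⊆_)
open import Data.List.Relation.Binary.Subset.Propositional.Properties using (Any-resp-⊆; All-resp-⊇)
open import Data.List.Relation.Unary.All as All using (All; []; _∷_; all?)
open import Data.List.Relation.Unary.All.Properties using (all-filter) renaming (map⁺ to All-map⁺; map⁻ to All-map⁻)
open import Data.List.Relation.Unary.Any using (Any; here; there)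
import Data.List.Relation.Unary.Unique.DecPropositional.Properties as UniqueDec
open import Data.List.Relation.Unary.Unique.Propositional using (Unique; []; _∷_)
open import Data.List.Relation.Unary.Unique.Propositional.Properties using () renaming (filter⁺ to Unique-filter⁺)
open import Data.Nat as ℕ using (zero; suc; s≤s; z≤n; _<_)
open import Data.Nat.Coprimality using (1-coprimeTo)
import Data.Nat.Properties as ℕ
open import Data.Product using (proj₁; proj₂; _,_)
open import Data.Product.Properties using () renaming (≡-dec to ×-≡-dec)
open import Data.Rational as ℚ using (0ℚ; 1ℚ; ½; _+_; _*_; _/_; mkℚ; *≤*; NonNegative)
import Data.Rational.Properties as ℚ
open import Data.Sum using (inj₁; inj₂)
open import Data.Vec using ([]; _∷_; lookup; zipWith; replicate)
open import Data.Vec.Properties using (lookup-zipWith)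
open import Function using (_∘_)
open import Relation.Binary.Bundles using (DecTotalOrder)
open import Relation.Binary.Definitions using (DecidableEquality)
open import Relation.Binary.PropositionalEquality
  using (_≡_; refl; sym; trans; cong; cong₂; subst; subst₂; module ≡-Reasoning)
open import Relation.Nullary using (does)
open import Relation.Nullary.Decidable using (map′; _→-dec_)
open import Relation.Unary using (Pred; Decidable)

open CommutativeSemigroupProperties (CommutativeMonoid.commutativeSemigroup ℚ.+-0-commutativeMonoid)
  using () renaming (interchange to +-interchange)
open CommutativeSemigroupProperties (CommutativeRing.+-commutativeSemigroup xor-∧-commutativeRing)
  using () renaming (interchange to xor-interchange)
open import Data.List.Extrema (DecTotalOrder.totalOrder ℚ.≤-decTotalOrder) using (argmax; argmax-all; f[xs]≤f[argmax])

private
  variable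
    A : Set
    n : ℕ

∑ : List A → (A → ℚ) → ℚ
∑ xs f = sumℚ (map f xs)

∑-cong : ∀ (xs : List A) {f g : A → ℚ} → (∀ x → f x ≡ g x) → ∑ xs f ≡ ∑ xs g
∑-cong []       f≡g = refl
∑-cong (x ∷ xs) f≡g = cong₂ _+_ (f≡g x) (∑-cong xs f≡g)

∑-mono : ∀ (xs : List A) {f g : A → ℚ} → (∀ x → f x ℚ.≤ g x) → ∑ xs f ℚ.≤ ∑ xs g
∑-mono []       f≤g = ℚ.≤-refl
∑-mono (x ∷ xs) f≤g = ℚ.+-mono-≤ (f≤g x) (∑-mono xs f≤g)

∑-++ : ∀ (xs ys : List A) (f : A → ℚ) → ∑ (xs ++ ys) f ≡ ∑ xs f + ∑ ys f
∑-++ []       ys f = sym (ℚ.+-identityˡ _)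
∑-++ (x ∷ xs) ys f = trans (cong (f x +_) (∑-++ xs ys f)) (sym (ℚ.+-assoc (f x) _ _))

∑-map : ∀ {B : Set} (h : A → B) (xs : List A) (f : B → ℚ) → ∑ (map h xs) f ≡ ∑ xs (f ∘ h)
∑-map h []       f = refl
∑-map h (x ∷ xs) f = cong (f (h x) +_) (∑-map h xs f)

∑-zero : ∀ (xs : List A) → ∑ xs (λ _ → 0ℚ) ≡ 0ℚ
∑-zero []       = refl
∑-zero (x ∷ xs) = trans (ℚ.+-identityˡ _) (∑-zero xs)

∑-+ : ∀ (xs : List A) (f g : A → ℚ) → ∑ xs (λ x → f x + g x) ≡ ∑ xs f + ∑ xs g
∑-+ []       f g = refl
∑-+ (x ∷ xs) f g = trans (cong (f x + g x +_) (∑-+ xs f g)) (+-interchange (f x) (g x) _ _)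

∑-*ʳ : ∀ (xs : List A) (f : A → ℚ) c → ∑ xs (λ x → f x * c) ≡ ∑ xs f * c
∑-*ʳ []       f c = sym (ℚ.*-zeroˡ c)
∑-*ʳ (x ∷ xs) f c = trans (cong (f x * c +_) (∑-*ʳ xs f c)) (sym (ℚ.*-distribʳ-+ c (f x) _))

∑-*ˡ : ∀ (xs : List A) c (f : A → ℚ) → ∑ xs (λ x → c * f x) ≡ c * ∑ xs f
∑-*ˡ []       c f = sym (ℚ.*-zeroʳ c)
∑-*ˡ (x ∷ xs) c f = trans (cong (c * f x +_) (∑-*ˡ xs c f)) (sym (ℚ.*-distribˡ-+ c (f x) _))

∑-swap : ∀ {B : Set} (xs : List A) (ys : List B) (F : A → B → ℚ) →
         ∑ xs (λ a → ∑ ys (F a)) ≡ ∑ ys (λ b → ∑ xs (λ a → F a b))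
∑-swap []       ys F = sym (∑-zero ys)
∑-swap (a ∷ xs) ys F = trans (cong (∑ ys (F a) +_) (∑-swap xs ys F)) (sym (∑-+ ys (F a) _))

∑-nonneg : ∀ (xs : List A) {f : A → ℚ} → (∀ x → 0ℚ ℚ.≤ f x) → 0ℚ ℚ.≤ ∑ xs f
∑-nonneg xs 0≤f = ℚ.≤-trans (ℚ.≤-reflexive (sym (∑-zero xs))) (∑-mono xs 0≤f)

∑-weighted-≤ : ∀ (xs : List A) {F w : A → ℚ} {M : ℚ} → (∀ x → 0ℚ ℚ.≤ w x) →
               (∀ x → F x ℚ.≤ M) → ∑ xs (λ x → F x * w x) ℚ.≤ M * ∑ xs w
∑-weighted-≤ xs {w = w} {M} 0≤w F≤M = ℚ.≤-trans
  (∑-mono xs (λ x → ℚ.*-monoʳ-≤-nonNeg (w x) {{ℚ.nonNegative (0≤w x)}} (F≤M x)))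
  (ℚ.≤-reflexive (∑-*ˡ xs M w))

∈-allInputs : ∀ (x : Input n) → x ∈ allInputs n
∈-allInputs []          = here refl
∈-allInputs (true ∷ x)  = ∈-++⁺ˡ (∈-map⁺ (true ∷_) (∈-allInputs x))
∈-allInputs {suc n} (false ∷ x) = ∈-++⁺ʳ (map (true ∷_) (allInputs n)) (∈-map⁺ (false ∷_) (∈-allInputs x))

∑-allInputs-suc : ∀ (F : Input (suc n) → ℚ) →
                  ∑ (allInputs (suc n)) F ≡ ∑ (allInputs n) (λ v → F (true ∷ v) + F (false ∷ v))
∑-allInputs-suc {n} F = begin
  ∑ (map (true ∷_) vs ++ map (false ∷_) vs) F
    ≡⟨ ∑-++ (map (true ∷_) vs) _ F ⟩
  ∑ (map (true ∷_) vs) F + ∑ (map (false ∷_) vs) F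
    ≡⟨ cong₂ _+_ (∑-map (true ∷_) vs F) (∑-map (false ∷_) vs F) ⟩
  ∑ vs (λ v → F (true ∷ v)) + ∑ vs (λ v → F (false ∷ v))
    ≡⟨ sym (∑-+ vs _ _) ⟩
  ∑ vs (λ v → F (true ∷ v) + F (false ∷ v)) ∎
  where open ≡-Reasoning
        vs = allInputs n

+-not-invariant : ∀ (h : Bool → ℚ) b → h (not b) + h b ≡ h true + h false
+-not-invariant h true  = ℚ.+-comm (h false) (h true)
+-not-invariant h false = refl

_⊕_ : Input n → Input n → Input n
_⊕_ = zipWith _xor_

parity-⊕ : ∀ (v x : Input n) → parity (v ⊕ x) ≡ parity v xor parity x
parity-⊕ []      []      = refl
parity-⊕ (a ∷ v) (b ∷ x) rewrite parity-⊕ v x = xor-interchange a b (parity v) (parity x)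

∑-allInputs-⊕ : ∀ (x : Input n) (g : Input n → ℚ) → ∑ (allInputs n) (λ v → g (v ⊕ x)) ≡ ∑ (allInputs n) g
∑-allInputs-⊕ []      g = refl
∑-allInputs-⊕ {suc n} (b ∷ x) g = begin
  ∑ (allInputs (suc n)) (λ v → g (v ⊕ (b ∷ x)))
    ≡⟨ ∑-allInputs-suc (λ v → g (v ⊕ (b ∷ x))) ⟩
  ∑ vs (λ v → g (not b ∷ v ⊕ x) + g (b ∷ v ⊕ x))
    ≡⟨ ∑-+ vs _ _ ⟩
  ∑ vs (λ v → g (not b ∷ v ⊕ x)) + ∑ vs (λ v → g (b ∷ v ⊕ x))
    ≡⟨ cong₂ _+_ (∑-allInputs-⊕ x _) (∑-allInputs-⊕ x _) ⟩
  ∑ vs (λ v → g (not b ∷ v)) + ∑ vs (λ v → g (b ∷ v))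
    ≡⟨ sym (∑-+ vs _ _) ⟩
  ∑ vs (λ v → g (not b ∷ v) + g (b ∷ v))
    ≡⟨ ∑-cong vs (λ v → +-not-invariant (λ c → g (c ∷ v)) b) ⟩
  ∑ vs (λ v → g (true ∷ v) + g (false ∷ v))
    ≡⟨ sym (∑-allInputs-suc g) ⟩
  ∑ (allInputs (suc n)) g ∎
  where open ≡-Reasoning
        vs = allInputs n

withParity : Bool → Input n → Input (suc n)
withParity b v = (b xor parity v) ∷ v

parity-withParity : ∀ b (v : Input n) → parity (withParity b v) ≡ b
parity-withParity b v = begin
  (b xor parity v) xor parity v ≡⟨ xor-assoc b (parity v) (parity v) ⟩
  b xor (parity v xor parity v) ≡⟨ cong (b xor_) (xor-same (parity v)) ⟩
  b xor false                   ≡⟨ xor-identityʳ b ⟩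
  b                             ∎
  where open ≡-Reasoning

∑-allInputs-withParity : ∀ (F : Input (suc n) → ℚ) →
  ∑ (allInputs (suc n)) F ≡ ∑ (allInputs n) (λ v → F (withParity true v) + F (withParity false v))
∑-allInputs-withParity {n} F = trans (∑-allInputs-suc F)
  (sym (∑-cong (allInputs n) (λ v → +-not-invariant (λ c → F (c ∷ v)) (parity v))))

withParity-⊕ : ∀ (v : Input n) b (x : Input n) →
               withParity false v ⊕ (b ∷ x) ≡ withParity (parity (b ∷ x)) (v ⊕ x)
withParity-⊕ v b x = cong (_∷ v ⊕ x) (sym (begin
  (b xor parity x) xor parity (v ⊕ x)             ≡⟨ cong ((b xor parity x) xor_) (parity-⊕ v x) ⟩
  (b xor parity x) xor (parity v xor parity x)    ≡⟨ xor-interchange b (parity x) (parity v) (parity x) ⟩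
  (b xor parity v) xor (parity x xor parity x)    ≡⟨ cong ((b xor parity v) xor_) (xor-same (parity x)) ⟩
  (b xor parity v) xor false                      ≡⟨ xor-identityʳ _ ⟩
  b xor parity v                                  ≡⟨ xor-comm b (parity v) ⟩
  parity v xor b                                  ∎))
  where open ≡-Reasoning

-- Clauses, CNFs and their translates

evalClause⇒Any : ∀ (c : Clause n) {x} → evalClause c x ≡ true → Any (λ l → evalLit l x ≡ true) c
evalClause⇒Any (l ∷ c) {x} sat with evalLit l x in l-true
... | true  = here l-true
... | false = there (evalClause⇒Any c sat)

Any⇒evalClause : ∀ {c : Clause n} {x} → Any (λ l → evalLit l x ≡ true) c → evalClause c x ≡ true
Any⇒evalClause (here l-true) rewrite l-true = refl
Any⇒evalClause {c = l ∷ _} {x} (there sat) rewrite Any⇒evalClause sat = ∨-zeroʳ (evalLit l x)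

evalClause-mono : ∀ {c d : Clause n} {x} → c ⊆ d → evalClause c x ≡ true → evalClause d x ≡ true
evalClause-mono {c = c} c⊆d = Any⇒evalClause ∘ Any-resp-⊆ c⊆d ∘ evalClause⇒Any c

evalCNF⇒All : ∀ (φ : CNF n) {x} → evalCNF φ x ≡ true → All (λ c → evalClause c x ≡ true) φ
evalCNF⇒All []      _   = []
evalCNF⇒All (c ∷ φ) {x} sat with evalClause c x in c-true
... | true = c-true ∷ evalCNF⇒All φ sat

All⇒evalCNF : ∀ {φ : CNF n} {x} → All (λ c → evalClause c x ≡ true) φ → evalCNF φ x ≡ true
All⇒evalCNF []               = refl
All⇒evalCNF (c-true ∷ sat) rewrite c-true = All⇒evalCNF sat

shiftLiteral : Input n → Literal n → Literal n
shiftLiteral w (i , b) = (i , b xor lookup w i)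

shift : Input n → CNF n → CNF n
shift w = map (map (shiftLiteral w))

evalLit-shift : ∀ (w : Input n) l x → evalLit (shiftLiteral w l) x ≡ evalLit l (w ⊕ x)
evalLit-shift w (i , true) x rewrite lookup-zipWith _xor_ i w x with lookup w i
... | true  = refl
... | false = refl
evalLit-shift w (i , false) x rewrite lookup-zipWith _xor_ i w x with lookup w i
... | true  = sym (not-involutive (lookup x i))
... | false = refl

evalClause-shift : ∀ (w : Input n) c x → evalClause (map (shiftLiteral w) c) x ≡ evalClause c (w ⊕ x)
evalClause-shift w []      x = refl
evalClause-shift w (l ∷ c) x = cong₂ _∨_ (evalLit-shift w l x) (evalClause-shift w c x)

evalCNF-shift : ∀ (w : Input n) φ x → evalCNF (shift w φ) x ≡ evalCNF φ (w ⊕ x)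
evalCNF-shift w []      x = refl
evalCNF-shift w (c ∷ φ) x = cong₂ _∧_ (evalClause-shift w c x) (evalCNF-shift w φ x)

shift-InCNF : ∀ {w : Input n} {φ} → parity w ≡ false → InCNF parity φ → InCNF parity (shift w φ)
shift-InCNF {w = w} {φ} w-even φ-in x sat = begin
  parity x              ≡⟨ cong (_xor parity x) (sym w-even) ⟩
  parity w xor parity x ≡⟨ sym (parity-⊕ w x) ⟩
  parity (w ⊕ x)        ≡⟨ φ-in (w ⊕ x) (trans (sym (evalCNF-shift w φ x)) sat) ⟩
  true                  ∎
  where open ≡-Reasoning

𝟙 : Bool → ℚ
𝟙 b = if b then 1ℚ else 0ℚ

prob-𝟙 : ∀ (μ : Input n → ℚ) φ → prob μ φ ≡ ∑ (allInputs n) (λ x → 𝟙 (evalCNF φ x) * μ x)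
prob-𝟙 μ φ = ∑-cong (allInputs _) (λ x → if-0 (evalCNF φ x) (μ x))
  where
  if-0 : ∀ b q → (if b then q else 0ℚ) ≡ 𝟙 b * q
  if-0 true  q = sym (ℚ.*-identityˡ q)
  if-0 false q = sym (ℚ.*-zeroˡ q)

prob-nonneg : ∀ {μ : Input n → ℚ} → (∀ x → 0ℚ ℚ.≤ μ x) → ∀ φ → 0ℚ ℚ.≤ prob μ φ
prob-nonneg {μ = μ} 0≤μ φ = ∑-nonneg (allInputs _) pointwise
  where
  pointwise : ∀ x → 0ℚ ℚ.≤ (if evalCNF φ x then μ x else 0ℚ)
  pointwise x with evalCNF φ x
  ... | true  = 0≤μ x
  ... | false = ℚ.≤-refl

prob-mono : ∀ {μ : Input n → ℚ} {φ ψ} → (∀ x → 0ℚ ℚ.≤ μ x) →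
            (∀ x → evalCNF φ x ≡ true → evalCNF ψ x ≡ true) → prob μ φ ℚ.≤ prob μ ψ
prob-mono {μ = μ} {φ} {ψ} 0≤μ φ⇒ψ = ∑-mono (allInputs _) pointwise
  where
  pointwise : ∀ x → (if evalCNF φ x then μ x else 0ℚ) ℚ.≤ (if evalCNF ψ x then μ x else 0ℚ)
  pointwise x with evalCNF φ x in φx | evalCNF ψ x in ψx
  ... | false | false = ℚ.≤-refl
  ... | false | true  = 0≤μ x
  ... | true  | true  = ℚ.≤-refl
  ... | true  | false with () ← trans (sym ψx) (φ⇒ψ x φx)

mean-const-on-support : ∀ {f : Input n → Bool} (ν : Distribution f) {g : Input n → ℚ} {c} →
  (∀ x → f x ≡ true → g x ≡ c) → ∑ (allInputs n) (λ x → g x * mass ν x) ≡ c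
mean-const-on-support {n} {f} ν {g} {c} g≡c = begin
  ∑ (allInputs n) (λ x → g x * mass ν x) ≡⟨ ∑-cong (allInputs n) pointwise ⟩
  ∑ (allInputs n) (λ x → c * mass ν x)   ≡⟨ ∑-*ˡ (allInputs n) c (mass ν) ⟩
  c * ∑ (allInputs n) (mass ν)           ≡⟨ cong (c *_) (total ν) ⟩
  c * 1ℚ                                 ≡⟨ ℚ.*-identityʳ c ⟩
  c                                      ∎
  where
  open ≡-Reasoning
  pointwise : ∀ x → g x * mass ν x ≡ c * mass ν x
  pointwise x with f x in fx
  ... | true  = cong (_* mass ν x) (g≡c x fx)
  ... | false rewrite support ν x fx = trans (ℚ.*-zeroʳ (g x)) (sym (ℚ.*-zeroʳ c))

-- The gcd inside _/_ does not reduce for a variable k, so 1/(k+1) is compared via its normal form.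
1/suc≡mkℚ : ∀ k → ℤ.+ 1 / suc k ≡ mkℚ (ℤ.+ 1) k (1-coprimeTo (suc k))
1/suc≡mkℚ k = ℚ.↥p/↧p≡p (mkℚ (ℤ.+ 1) k (1-coprimeTo (suc k)))

1/suc-antimono : ∀ {a b} → b ℕ.≤ a → ℤ.+ 1 / suc a ℚ.≤ ℤ.+ 1 / suc b
1/suc-antimono {a} {b} b≤a rewrite 1/suc≡mkℚ a | 1/suc≡mkℚ b =
  *≤* (subst₂ ℤ._≤_ (sym (ℤ.*-identityˡ _)) (sym (ℤ.*-identityˡ _)) (ℤ.+≤+ (s≤s b≤a)))

ratio-nonneg : ∀ {μ : Input n → ℚ} φ → 0ℚ ℚ.≤ prob μ φ → 0ℚ ℚ.≤ ratio μ φ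
ratio-nonneg []      _   = ℚ.≤-refl
ratio-nonneg {μ = μ} (c ∷ φ) 0≤p = ℚ.nonNegative⁻¹ _
  {{ℚ.nonNeg*nonNeg⇒nonNeg (prob μ (c ∷ φ)) {{ℚ.nonNegative 0≤p}} _ {{ℚ.normalize-nonNeg 1 (suc (length φ))}}}}

-- ratio μ [] = 0 by the 0/0 convention, hence the hypothesis that ψ is nonempty when φ is.
ratio-mono : ∀ {μ ν : Input n → ℚ} {φ ψ : CNF n} → 0ℚ ℚ.≤ prob μ φ → prob μ φ ℚ.≤ prob ν ψ →
             size ψ ≤ size φ → (0 < size φ → 0 < size ψ) → ratio μ φ ℚ.≤ ratio ν ψ
ratio-mono {φ = []} {ψ} 0≤p p≤q _ _ = ratio-nonneg ψ (ℚ.≤-trans 0≤p p≤q)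
ratio-mono {φ = _ ∷ _} {[]} _ _ _ nonempty with () ← nonempty (s≤s z≤n)
ratio-mono {μ = μ} {ν} {c ∷ φ} {d ∷ ψ} 0≤p p≤q (s≤s |ψ|≤|φ|) _ = begin
  prob μ (c ∷ φ) * (ℤ.+ 1 / suc (length φ))
    ≤⟨ ℚ.*-monoˡ-≤-nonNeg (prob μ (c ∷ φ)) {{ℚ.nonNegative 0≤p}} (1/suc-antimono |ψ|≤|φ|) ⟩
  prob μ (c ∷ φ) * (ℤ.+ 1 / suc (length ψ))
    ≤⟨ ℚ.*-monoʳ-≤-nonNeg (ℤ.+ 1 / suc (length ψ)) {{ℚ.normalize-nonNeg 1 (suc (length ψ))}} p≤q ⟩
  prob ν (d ∷ ψ) * (ℤ.+ 1 / suc (length ψ)) ∎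
  where open ℚ.≤-Reasoning

-- The maximum defining D_μ(f) is attained

sublists : List A → List (List A)
sublists []       = [ [] ]
sublists (x ∷ xs) = map (x ∷_) (sublists xs) ++ sublists xs

filter∈sublists : ∀ {p} {P : Pred A p} (P? : Decidable P) xs → filter P? xs ∈ sublists xs
filter∈sublists P? []       = here refl
filter∈sublists P? (x ∷ xs) with does (P? x)
... | true  = ∈-++⁺ˡ (∈-map⁺ (x ∷_) (filter∈sublists P? xs))
... | false = ∈-++⁺ʳ (map (x ∷_) (sublists xs)) (filter∈sublists P? xs)

Unique-⊆⇒length-≤ : ∀ {xs ys : List A} → Unique xs → xs ⊆ ys → length xs ≤ length ys
Unique-⊆⇒length-≤ [] _ = z≤n
Unique-⊆⇒length-≤ {xs = x ∷ xs} (x∉xs ∷ xs!) xs⊆ys with ∈-∃++ (xs⊆ys (here refl))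
... | ys₁ , ys₂ , refl = begin
  suc (length xs)           ≤⟨ s≤s (Unique-⊆⇒length-≤ xs! xs⊆ys₁++ys₂) ⟩
  suc (length (ys₁ ++ ys₂)) ≡⟨ sym (↭-length (↭-shift x ys₁ ys₂)) ⟩
  length (ys₁ ++ x ∷ ys₂)   ∎
  where
  open ℕ.≤-Reasoning
  xs⊆ys₁++ys₂ : xs ⊆ ys₁ ++ ys₂
  xs⊆ys₁++ys₂ {y} y∈xs with ∈-++⁻ ys₁ (xs⊆ys (there y∈xs))
  ... | inj₁ y∈ys₁         = ∈-++⁺ˡ y∈ys₁
  ... | inj₂ (here refl)   = ⊥-elim (All.lookup x∉xs y∈xs refl)
  ... | inj₂ (there y∈ys₂) = ∈-++⁺ʳ ys₁ y∈ys₂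

_≟ˡ_ : DecidableEquality (Literal n)
_≟ˡ_ = ×-≡-dec _≟ᶠ_ _≟ᵇ_

_≟ᶜ_ : DecidableEquality (Clause n)
_≟ᶜ_ = List-≡-dec _≟ˡ_

allLiterals : (n : ℕ) → List (Literal n)
allLiterals n = cartesianProduct (allFin n) (true ∷ false ∷ [])

∈-allLiterals : ∀ (l : Literal n) → l ∈ allLiterals n
∈-allLiterals (i , true)  = ∈-cartesianProduct⁺ (∈-allFin i) (here refl)
∈-allLiterals (i , false) = ∈-cartesianProduct⁺ (∈-allFin i) (there (here refl))

module _ {n : ℕ} where
  open DecMembership (_≟ˡ_ {n}) using () renaming (_∈?_ to _∈ˡ?_)
  open DecMembership (_≟ᶜ_ {n}) using () renaming (_∈?_ to _∈ᶜ?_)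

  normClause : Clause n → Clause n
  normClause c = filter (_∈ˡ? c) (allLiterals n)

  ⊆-normClause : ∀ c → c ⊆ normClause c
  ⊆-normClause c {l} l∈c = ∈-filter⁺ (_∈ˡ? c) (∈-allLiterals l) l∈c

  normClause-⊆ : ∀ c → normClause c ⊆ c
  normClause-⊆ c l∈ = proj₂ (∈-filter⁻ (_∈ˡ? c) {xs = allLiterals n} l∈)

  -- Deduplicated so that normCNF φ repeats no clause, which bounds its size by that of φ.
  allClauses : List (Clause n)
  allClauses = deduplicate _≟ᶜ_ (sublists (allLiterals n))

  normClause∈allClauses : ∀ c → normClause c ∈ allClauses
  normClause∈allClauses c = ∈-deduplicate⁺ _≟ᶜ_ (filter∈sublists (_∈ˡ? c) (allLiterals n))

  normCNF : CNF n → CNF n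
  normCNF φ = filter (_∈ᶜ? map normClause φ) allClauses

  allCNFs : List (CNF n)
  allCNFs = sublists allClauses

  normCNF∈allCNFs : ∀ φ → normCNF φ ∈ allCNFs
  normCNF∈allCNFs φ = filter∈sublists (_∈ᶜ? map normClause φ) allClauses

  normCNF-⊆ : ∀ φ → normCNF φ ⊆ map normClause φ
  normCNF-⊆ φ c∈ = proj₂ (∈-filter⁻ (_∈ᶜ? map normClause φ) {xs = allClauses} c∈)

  ⊆-normCNF : ∀ φ → map normClause φ ⊆ normCNF φ
  ⊆-normCNF φ c∈ with ∈-map⁻ normClause c∈
  ... | c , _ , refl = ∈-filter⁺ (_∈ᶜ? map normClause φ) (normClause∈allClauses c) c∈

  size-normCNF : ∀ φ → size (normCNF φ) ≤ size φ
  size-normCNF φ = ℕ.≤-trans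
    (Unique-⊆⇒length-≤ (Unique-filter⁺ (_∈ᶜ? map normClause φ) allClauses!) (normCNF-⊆ φ))
    (ℕ.≤-reflexive (length-map normClause φ))
    where allClauses! = UniqueDec.deduplicate-! _≟ᶜ_ (sublists (allLiterals n))

  normCNF-nonempty : ∀ φ → 0 < size φ → 0 < size (normCNF φ)
  normCNF-nonempty (c ∷ φ) _ with normCNF (c ∷ φ) | ⊆-normCNF (c ∷ φ) (here refl)
  ... | _ ∷ _ | _ = s≤s z≤n

  evalCNF-normCNF⁺ : ∀ φ {x} → evalCNF φ x ≡ true → evalCNF (normCNF φ) x ≡ true
  evalCNF-normCNF⁺ φ sat = All⇒evalCNF (All-resp-⊇ (normCNF-⊆ φ)
    (All-map⁺ (All.map (λ {c} → evalClause-mono (⊆-normClause c)) (evalCNF⇒All φ sat))))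

  evalCNF-normCNF⁻ : ∀ φ {x} → evalCNF (normCNF φ) x ≡ true → evalCNF φ x ≡ true
  evalCNF-normCNF⁻ φ sat = All⇒evalCNF (All.map (λ {c} → evalClause-mono (normClause-⊆ c))
    (All-map⁻ (All-resp-⊇ (⊆-normCNF φ) (evalCNF⇒All (normCNF φ) sat))))

  ratio-≤-normCNF : ∀ {μ : Input n → ℚ} → (∀ x → 0ℚ ℚ.≤ μ x) → ∀ φ → ratio μ φ ℚ.≤ ratio μ (normCNF φ)
  ratio-≤-normCNF 0≤μ φ = ratio-mono {φ = φ} {normCNF φ} (prob-nonneg 0≤μ φ)
    (prob-mono {φ = φ} {normCNF φ} 0≤μ (λ _ → evalCNF-normCNF⁺ φ))
    (size-normCNF φ) (normCNF-nonempty φ)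

InCNF? : ∀ (f : Input n → Bool) → Decidable (InCNF f)
InCNF? f φ = map′ (λ all x → All.lookup all (∈-allInputs x)) (λ in-f → All.tabulate (λ {x} _ → in-f x))
  (all? (λ x → (evalCNF φ x ≟ᵇ true) →-dec (f x ≟ᵇ true)) (allInputs _))

Dμ-attained : ∀ (f : Input n → Bool) (μ : Input n → ℚ) → (∀ x → 0ℚ ℚ.≤ μ x) → Σ ℚ (IsDμ f μ)
Dμ-attained f μ 0≤μ = ratio μ best , (best , best-in , refl) , best-max
  where
  candidates = filter (InCNF? f) allCNFs
  best = argmax (ratio μ) [ [] ] candidates

  best-in : InCNF f best
  best-in = argmax-all (ratio μ) {P = InCNF f} (λ _ ()) (all-filter (InCNF? f) allCNFs)

  best-max : ∀ φ → InCNF f φ → ratio μ φ ℚ.≤ ratio μ best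
  best-max φ φ-in = ℚ.≤-trans (ratio-≤-normCNF 0≤μ φ)
    (All.lookup (f[xs]≤f[argmax] {f = ratio μ} [ [] ] candidates)
      (∈-filter⁺ (InCNF? f) (normCNF∈allCNFs φ) (λ x → φ-in x ∘ evalCNF-normCNF⁻ φ)))

-- Parity

halfPow-nonneg : ∀ m → 0ℚ ℚ.≤ halfPow m
halfPow-nonneg m = ℚ.nonNegative⁻¹ (halfPow m) {{nonNeg m}}
  where
  nonNeg : ∀ m → NonNegative (halfPow m)
  nonNeg zero    = _
  nonNeg (suc m) = ℚ.nonNeg*nonNeg⇒nonNeg ½ (halfPow m) {{nonNeg m}}

∑-halfPow : ∀ m → ∑ (allInputs m) (λ _ → halfPow m) ≡ 1ℚ
∑-halfPow zero    = refl
∑-halfPow (suc m) = begin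
  ∑ (allInputs (suc m)) (λ _ → ½ * halfPow m)        ≡⟨ ∑-allInputs-suc {n = m} (λ _ → ½ * halfPow m) ⟩
  ∑ vs (λ _ → ½ * halfPow m + ½ * halfPow m)         ≡⟨ ∑-+ vs (λ _ → ½ * halfPow m) (λ _ → ½ * halfPow m) ⟩
  ∑ vs (λ _ → ½ * halfPow m) + ∑ vs (λ _ → ½ * halfPow m)
    ≡⟨ cong₂ _+_ (∑-*ˡ vs ½ (λ _ → halfPow m)) (∑-*ˡ vs ½ (λ _ → halfPow m)) ⟩
  ½ * ∑ vs (λ _ → halfPow m) + ½ * ∑ vs (λ _ → halfPow m) ≡⟨ cong (λ s → ½ * s + ½ * s) (∑-halfPow m) ⟩
  ½ * 1ℚ + ½ * 1ℚ                                    ≡⟨⟩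
  1ℚ                                                 ∎
  where
  open ≡-Reasoning
  vs = allInputs m

module _ {m : ℕ} where

  uniformParity-withParity : ∀ b (v : Input m) →
    uniformParity (suc m) (withParity b v) ≡ (if b then halfPow m else 0ℚ)
  uniformParity-withParity b v = cong (λ p → if p then halfPow m else 0ℚ) (parity-withParity b v)

  uniformDistribution : Distribution (parity {suc m})
  uniformDistribution = record
    { mass    = uniformParity (suc m)
    ; nonneg  = λ x → nonneg-if (parity x)
    ; support = λ x even → cong (λ p → if p then halfPow m else 0ℚ) even
    ; total   = trans (∑-allInputs-withParity (uniformParity (suc m)))
                  (trans (∑-cong (allInputs m) h+0≡h) (∑-halfPow m))
    }
    where
    nonneg-if : ∀ b → 0ℚ ℚ.≤ (if b then halfPow m else 0ℚ)
    nonneg-if true  = halfPow-nonneg m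
    nonneg-if false = ℚ.≤-refl
    h+0≡h : ∀ v → uniformParity (suc m) (withParity true v) + uniformParity (suc m) (withParity false v) ≡ halfPow m
    h+0≡h v = trans (cong₂ _+_ (uniformParity-withParity true v) (uniformParity-withParity false v))
                    (ℚ.+-identityʳ (halfPow m))

  oddCount : CNF (suc m) → ℚ
  oddCount φ = ∑ (allInputs m) (λ v → 𝟙 (evalCNF φ (withParity true v)))

  prob-uniform : ∀ φ → prob (uniformParity (suc m)) φ ≡ oddCount φ * halfPow m
  prob-uniform φ = begin
    prob u φ
      ≡⟨ prob-𝟙 u φ ⟩
    ∑ (allInputs (suc m)) (λ x → 𝟙 (evalCNF φ x) * u x)
      ≡⟨ ∑-allInputs-withParity (λ x → 𝟙 (evalCNF φ x) * u x) ⟩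
    ∑ vs (λ v → 𝟙 (evalCNF φ (withParity true v)) * u (withParity true v)
              + 𝟙 (evalCNF φ (withParity false v)) * u (withParity false v))
      ≡⟨ ∑-cong vs pointwise ⟩
    ∑ vs (λ v → 𝟙 (evalCNF φ (withParity true v)) * halfPow m)
      ≡⟨ ∑-*ʳ vs _ (halfPow m) ⟩
    oddCount φ * halfPow m ∎
    where
    open ≡-Reasoning
    u = uniformParity (suc m)
    vs = allInputs m
    pointwise : ∀ v → 𝟙 (evalCNF φ (withParity true v)) * u (withParity true v)
                      + 𝟙 (evalCNF φ (withParity false v)) * u (withParity false v)
                    ≡ 𝟙 (evalCNF φ (withParity true v)) * halfPow m
    pointwise v rewrite uniformParity-withParity true v | uniformParity-withParity false v =
      trans (cong (𝟙 (evalCNF φ (withParity true v)) * halfPow m +_) (ℚ.*-zeroʳ (𝟙 (evalCNF φ (withParity false v))))) (ℚ.+-identityʳ _)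

  ∑-prob-shift-even : ∀ (ν : Distribution (parity {suc m})) φ →
    ∑ (allInputs m) (λ v → prob (mass ν) (shift (withParity false v) φ)) ≡ oddCount φ
  ∑-prob-shift-even ν φ = begin
    ∑ vs (λ v → prob (mass ν) (shift (w v) φ))
      ≡⟨ ∑-cong vs (λ v → trans (prob-𝟙 (mass ν) (shift (w v) φ))
           (∑-cong xs (λ x → cong (λ b → 𝟙 b * mass ν x) (evalCNF-shift (w v) φ x)))) ⟩
    ∑ vs (λ v → ∑ xs (λ x → 𝟙 (evalCNF φ (w v ⊕ x)) * mass ν x))
      ≡⟨ ∑-swap vs xs _ ⟩
    ∑ xs (λ x → ∑ vs (λ v → 𝟙 (evalCNF φ (w v ⊕ x)) * mass ν x))
      ≡⟨ ∑-cong xs (λ x → ∑-*ʳ vs _ (mass ν x)) ⟩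
    ∑ xs (λ x → ∑ vs (λ v → 𝟙 (evalCNF φ (w v ⊕ x))) * mass ν x)
      ≡⟨ mean-const-on-support ν oddCount-shift ⟩
    oddCount φ ∎
    where
    open ≡-Reasoning
    vs = allInputs m
    xs = allInputs (suc m)
    w = withParity false
    oddCount-shift : ∀ x → parity x ≡ true → ∑ vs (λ v → 𝟙 (evalCNF φ (w v ⊕ x))) ≡ oddCount φ
    oddCount-shift (b ∷ x) odd = begin
      ∑ vs (λ v → 𝟙 (evalCNF φ (w v ⊕ (b ∷ x))))
        ≡⟨ ∑-cong vs (λ v → cong (𝟙 ∘ evalCNF φ) (withParity-⊕ v b x)) ⟩
      ∑ vs (λ v → 𝟙 (evalCNF φ (withParity (parity (b ∷ x)) (v ⊕ x))))
        ≡⟨ cong (λ p → ∑ vs (λ v → 𝟙 (evalCNF φ (withParity p (v ⊕ x))))) odd ⟩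
      ∑ vs (λ v → 𝟙 (evalCNF φ (withParity true (v ⊕ x))))
        ≡⟨ ∑-allInputs-⊕ x (λ v → 𝟙 (evalCNF φ (withParity true v))) ⟩
      oddCount φ ∎

  prob-uniform-≤-shift : ∀ (ν : Distribution (parity {suc m})) φ →
    Σ (Input m) (λ v → prob (uniformParity (suc m)) φ ℚ.≤ prob (mass ν) (shift (withParity false v) φ))
  prob-uniform-≤-shift ν φ = v* , (begin
    prob (uniformParity (suc m)) φ  ≡⟨ prob-uniform φ ⟩
    oddCount φ * halfPow m          ≡⟨ cong (_* halfPow m) (sym (∑-prob-shift-even ν φ)) ⟩
    ∑ vs F * halfPow m              ≡⟨ sym (∑-*ʳ vs F (halfPow m)) ⟩
    ∑ vs (λ v → F v * halfPow m)    ≤⟨ ∑-weighted-≤ vs (λ _ → halfPow-nonneg m) F≤F[v*] ⟩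
    F v* * ∑ vs (λ _ → halfPow m)   ≡⟨ cong (F v* *_) (∑-halfPow m) ⟩
    F v* * 1ℚ                       ≡⟨ ℚ.*-identityʳ (F v*) ⟩
    F v*                            ∎)
    where
    open ℚ.≤-Reasoning
    vs = allInputs m
    F : Input m → ℚ
    F v = prob (mass ν) (shift (withParity false v) φ)
    v* = argmax F (replicate m false) vs
    F≤F[v*] : ∀ v → F v ℚ.≤ F v*
    F≤F[v*] v = All.lookup (f[xs]≤f[argmax] {f = F} (replicate m false) vs) (∈-allInputs v)

  Dμ-uniform-≤ : ∀ {d d′} (ν : Distribution (parity {suc m})) →
    IsDμ parity (uniformParity (suc m)) d → IsDμ parity (mass ν) d′ → d ℚ.≤ d′
  Dμ-uniform-≤ ν ((φ , φ-in , refl) , _) (_ , ν-max) = ℚ.≤-trans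
    (ratio-mono {φ = φ} {shift w φ} (prob-nonneg (nonneg uniformDistribution) φ) (proj₂ beaten)
      (ℕ.≤-reflexive |shift-φ|≡|φ|) (subst (0 <_) (sym |shift-φ|≡|φ|)))
    (ν-max (shift w φ) (shift-InCNF {w = w} {φ} (parity-withParity false (proj₁ beaten)) φ-in))
    where
    beaten = prob-uniform-≤-shift ν φ
    w = withParity false (proj₁ beaten)
    |shift-φ|≡|φ| : size (shift w φ) ≡ size φ
    |shift-φ|≡|φ| = length-map (map (shiftLiteral w)) φ

corollary3p3 : (n : ℕ) → 1 ≤ n →
    Σ ℚ (λ d → IsDμ (parity {n}) (uniformParity n) d × IsD (parity {n}) d)
corollary3p3 (suc m) _ = d , Dμ , (uniformDistribution , Dμ) , λ ν _ → Dμ-uniform-≤ ν Dμ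
  where
  attained = Dμ-attained parity (uniformParity (suc m)) (nonneg uniformDistribution)
  d = proj₁ attained
  Dμ = proj₂ attained
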